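{- For every positive integer $n$ and every integer $k$, \[ \sum_{J\in\binom{[n]}{k}^{*}} \prod_{j\in J} j^2 \;=\; \sum_{J\in\binom{[n]}{k}^{**}} \prod_{j\in J} j\,(n + 1 - j). \]
   Context: $[n]=\{1,2,\dots,n\}$. $\binom{[n]}{k}^{*}$ denotes the collection of $k$-element subsets of $[n]$ all of whose elements are congruent to $n$ modulo $2$. $\binom{[n]}{k}^{**}$ denotes the collection of $k$-element subsets of $[n]$ that do not contain two consecutive integers. A sum over an empty collection is $0$ (so both sides vanish for $k<0$), and the empty product is $1$. -}

module Defs where

open import Data.Nat using (ℕ; zero; suc; _+_; _*_; _∸_; _%_; _≡ᵇ_)
open import Data.Bool using (Bool; true; false; _∧_; not; if_then_else_)
open import Data.Fin using (Fin; toℕ)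
open import Data.Vec using (Vec; []; _∷_; lookup)
open import Data.List using (List; []; _∷_; map; _++_; allFin; filterᵇ; length)
open import Data.Bool.ListAction using (all)
open import Data.Nat.ListAction using (sum; product)
open import Data.Integer using (ℤ; +_; -[1+_])

-- A subset J of [n] = {1,…,n} is a characteristic vector  Vec Bool n
-- (Data.Fin.Subset.Subset n); index i : Fin n stands for j = toℕ i + 1.
Sub : ℕ → Set
Sub n = Vec Bool n

elt : {n : ℕ} → Fin n → ℕ
elt i = suc (toℕ i)

_∈ᵇ_ : {n : ℕ} → Fin n → Sub n → Bool
i ∈ᵇ J = lookup J i

members : {n : ℕ} → Sub n → List (Fin n)
members {n} J = filterᵇ (_∈ᵇ J) (allFin n)

card : {n : ℕ} → Sub n → ℕ
card J = length (members J)

allSubsets : (n : ℕ) → List (Sub n)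
allSubsets zero    = [] ∷ []
allSubsets (suc n) = map (true ∷_) (allSubsets n) ++ map (false ∷_) (allSubsets n)

sumOver : (n : ℕ) → (Sub n → Bool) → (Sub n → ℕ) → ℕ
sumOver n P f = sum (map f (filterᵇ P (allSubsets n)))

prodOver : {n : ℕ} → (ℕ → ℕ) → Sub n → ℕ
prodOver g J = product (map (λ i → g (elt i)) (members J))

hasCard : {n : ℕ} → ℤ → Sub n → Bool
hasCard (+ k) J = card J ≡ᵇ k
hasCard -[1+ _ ] J  = false

sameParity : (n : ℕ) → Sub n → Bool
sameParity n J = all (λ i → (elt i % 2) ≡ᵇ (n % 2)) (members J)

noConsec : (n : ℕ) → Sub n → Bool
noConsec n J = all (λ i → all (λ i' → not (elt i' ≡ᵇ suc (elt i))) (members J)) (members J)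

inStar : (n : ℕ) → ℤ → Sub n → Bool
inStar n k J = hasCard k J ∧ sameParity n J

inStarStar : (n : ℕ) → ℤ → Sub n → Bool
inStarStar n k J = hasCard k J ∧ noConsec n J

-- Both sides are coefficients of the characteristic polynomial K_N of the Sylvester–Kac matrix
-- of order N = n + 1: the tridiagonal continuant with x on the diagonal and off-diagonal
-- products j (N − j), 1 ≤ j < N. Expanding the continuant along its first row gives
-- K_N x = Σ_k (−1)^k I_k x^(N − 2k), where I_k is the right-hand side (subsets of {1,…,n}
-- without two consecutive elements). Raising N by one shifts the argument,
-- K_(N+1) x = (x − N) K_N (x + 1), so K_N x = ∏_{i<N} (x − n + 2i): a product of factors
-- x² − j² with j ≤ n, j ≡ n (mod 2), and a factor x when n is even. Its coefficients are
-- (−1)^k times the left-hand side. Two such polynomials that agree at every positive integer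
-- have the same coefficients.
module Submission where

open import Defs

open import Function using (_∘_)
open import Relation.Binary.PropositionalEquality
  using (_≡_; refl; sym; trans; cong; cong₂; subst; module ≡-Reasoning)

module WeightedCounts where

  open import Data.Bool using (Bool; true; false)
  open import Data.Nat
  open import Data.Nat.Properties
  open import Data.Nat.Tactic.RingSolver using (solve-∀)

  𝟙 : Bool → ℕ
  𝟙 true  = 1
  𝟙 false = 0

  -- esym P g n k = Σ { ∏_{j ∈ J} g j | J ⊆ {1,…,n}, |J| = k, P holds on J }
  esym : (ℕ → Bool) → (ℕ → ℕ) → ℕ → ℕ → ℕ
  esym P g n       zero    = 1
  esym P g zero    (suc k) = 0
  esym P g (suc n) (suc k) =
    esym (P ∘ suc) (g ∘ suc) n (suc k) + 𝟙 (P 1) * (g 1 * esym (P ∘ suc) (g ∘ suc) n k)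

  esym-last : ∀ P g n k →
    esym P g (suc n) (suc k) ≡ esym P g n (suc k) + 𝟙 (P (suc n)) * (g (suc n) * esym P g n k)
  esym-last P g zero    zero    = refl
  esym-last P g zero    (suc k) = refl
  esym-last P g (suc n) zero    =
    trans (cong (_+ 𝟙 (P 1) * (g 1 * 1)) (esym-last (P ∘ suc) (g ∘ suc) n 0))
          (swap (esym (P ∘ suc) (g ∘ suc) n 1) (𝟙 (P (2 + n))) (g (2 + n)) (𝟙 (P 1)) (g 1))
    where
    swap : ∀ a p q p₁ q₁ → a + p * (q * 1) + p₁ * (q₁ * 1) ≡ a + p₁ * (q₁ * 1) + p * (q * 1)
    swap = solve-∀
  esym-last P g (suc n) (suc k) =
    trans (cong₂ (λ u v → u + 𝟙 (P 1) * (g 1 * v))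
                 (esym-last (P ∘ suc) (g ∘ suc) n (suc k)) (esym-last (P ∘ suc) (g ∘ suc) n k))
          (swap (esym (P ∘ suc) (g ∘ suc) n (2 + k)) (esym (P ∘ suc) (g ∘ suc) n (suc k))
                (esym (P ∘ suc) (g ∘ suc) n k) (𝟙 (P (2 + n))) (g (2 + n)) (𝟙 (P 1)) (g 1))
    where
    swap : ∀ a b c p q p₁ q₁ → a + p * (q * b) + p₁ * (q₁ * (b + p * (q * c)))
                             ≡ a + p₁ * (q₁ * b) + p * (q * (b + p₁ * (q₁ * c)))
    swap = solve-∀

  sameParityᵇ : ℕ → ℕ → Bool
  sameParityᵇ n j = (j % 2) ≡ᵇ (n % 2)

  square : ℕ → ℕ
  square j = j * j

  squareEsym : ℕ → ℕ → ℕ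
  squareEsym n = esym (sameParityᵇ n) square n

  sameParityᵇ-refl : ∀ n → sameParityᵇ n n ≡ true
  sameParityᵇ-refl n = go (n % 2)
    where
    go : ∀ r → (r ≡ᵇ r) ≡ true
    go zero    = refl
    go (suc r) = go r

  sameParityᵇ-suc : ∀ n → sameParityᵇ n (suc n) ≡ false
  sameParityᵇ-suc zero          = refl
  sameParityᵇ-suc (suc zero)    = refl
  sameParityᵇ-suc (suc (suc n)) = sameParityᵇ-suc n

  squareEsym-skip : ∀ n k → esym (sameParityᵇ n) square (suc n) k ≡ squareEsym n k
  squareEsym-skip n zero = refl
  squareEsym-skip n (suc k)
    rewrite esym-last (sameParityᵇ n) square n k | sameParityᵇ-suc n = +-identityʳ _

  -- sameParityᵇ (2 + n) and sameParityᵇ n coincide definitionally.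
  squareEsym-step : ∀ n k →
    squareEsym (2 + n) (suc k) ≡ squareEsym n (suc k) + square (2 + n) * squareEsym n k
  squareEsym-step n k
    rewrite esym-last (sameParityᵇ n) square (suc n) k | sameParityᵇ-refl (2 + n)
          | squareEsym-skip n (suc k) | squareEsym-skip n k
    = cong (squareEsym n (suc k) +_) (*-identityˡ _)

  halve-< : ∀ e k → 3 + e < suc k + suc k → suc e < k + k
  halve-< e k lt = ≤-pred (subst (3 + e ≤_) (+-suc k k) (≤-pred lt))

  squareEsym-vanish : ∀ n k → suc n < k + k → squareEsym n k ≡ 0
  squareEsym-vanish zero          (suc k)          _  = refl
  squareEsym-vanish (suc zero)    (suc zero)       (s≤s (s≤s ()))
  squareEsym-vanish (suc zero)    (suc (suc k))    _  = refl
  squareEsym-vanish (suc (suc n)) (suc k)          lt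
    rewrite squareEsym-step n k
          | squareEsym-vanish n (suc k) (<-trans (n<1+n _) (<-trans (n<1+n _) lt))
          | squareEsym-vanish n k (halve-< n k lt) = *-zeroʳ (square (2 + n))

  -- indep g e k = Σ { ∏_{j ∈ J} g j | J ⊆ {1,…,e}, |J| = k, no two elements of J consecutive }
  indep : (ℕ → ℕ) → ℕ → ℕ → ℕ
  indep g e             zero          = 1
  indep g zero          (suc k)       = 0
  indep g (suc zero)    (suc zero)    = g 1
  indep g (suc zero)    (suc (suc k)) = 0
  indep g (suc (suc e)) (suc k)       =
    indep (g ∘ suc) (suc e) (suc k) + g 1 * indep (g ∘ suc ∘ suc) e k

  kacWeight : ℕ → ℕ → ℕ
  kacWeight N j = j * (N ∸ j)

  indep-vanish : ∀ g e k → suc e < k + k → indep g e k ≡ 0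
  indep-vanish g zero          (suc k)       _  = refl
  indep-vanish g (suc zero)    (suc zero)    (s≤s (s≤s ()))
  indep-vanish g (suc zero)    (suc (suc k)) _  = refl
  indep-vanish g (suc (suc e)) (suc k)       lt
    rewrite indep-vanish (g ∘ suc) (suc e) (suc k) (<-trans (n<1+n _) lt)
          | indep-vanish (g ∘ suc ∘ suc) e k (halve-< e k lt) = *-zeroʳ (g 1)

module KacPolynomials where

  open WeightedCounts

  open import Data.Nat using (ℕ; zero; suc; 2+; _<_; _≤_; z≤n; s≤s)
  import Data.Nat as ℕ
  import Data.Nat.Properties as ℕ
  open import Data.Integer using (ℤ; +_; -_; _+_; _-_; _*_; _^_; ∣_∣; 0ℤ; 1ℤ)
  open import Data.Integer.Properties
  open import Data.Integer.Divisibility using (_∣_; divides)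
  open import Data.Nat.Divisibility using (>⇒∤)
  open import Data.Empty using (⊥-elim)
  open import Data.Sum using (_⊎_; inj₁; inj₂)
  open import Data.Product using (Σ; _,_)
  open import Relation.Nullary using (yes; no)
  open import Data.Integer.Tactic.RingSolver using (solve-∀)
  open ≡-Reasoning

  -- The determinant of the m × m tridiagonal matrix with x on the diagonal whose pairs of
  -- off-diagonal entries multiply to g 1, …, g (m − 1); expanded along the first row.
  continuant : (ℕ → ℤ) → ℕ → ℤ → ℤ
  continuant g zero          x = 1ℤ
  continuant g (suc zero)    x = x
  continuant g (suc (suc m)) x =
    x * continuant (g ∘ suc) (suc m) x - g 1 * continuant (g ∘ suc ∘ suc) m x

  continuant-last : ∀ g m x →
    continuant g (2+ m) x ≡ x * continuant g (suc m) x - g (suc m) * continuant g m x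
  continuant-last g zero          x = refl
  continuant-last g (suc zero)    x = swap x (g 1) (g 2)
    where
    swap : ∀ x a b → x * (x * x - b * 1ℤ) - a * x ≡ x * (x * x - a * 1ℤ) - b * x
    swap = solve-∀
  continuant-last g (suc (suc m)) x =
    trans (cong₂ (λ u v → x * u - g 1 * v)
                 (continuant-last (g ∘ suc) (suc m) x) (continuant-last (g ∘ suc ∘ suc) m x))
          (swap x (g 1) (g (suc (2+ m))) _ _ _ _)
    where
    swap : ∀ x a b p₁ p₀ q₁ q₀ →
      x * (x * p₁ - b * p₀) - a * (x * q₁ - b * q₀) ≡ x * (x * p₁ - a * q₁) - b * (x * p₀ - a * q₀)
    swap = solve-∀

  continuant-cong : ∀ g h m x → (∀ j → j < m → g (suc j) ≡ h (suc j)) →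
                    continuant g m x ≡ continuant h m x
  continuant-cong g h zero          x eq = refl
  continuant-cong g h (suc zero)    x eq = refl
  continuant-cong g h (suc (suc m)) x eq =
    cong₂ (λ u v → x * u - v)
      (continuant-cong (g ∘ suc) (h ∘ suc) (suc m) x (λ j lt → eq (suc j) (s≤s lt)))
      (cong₂ _*_ (eq 0 (s≤s z≤n))
         (continuant-cong (g ∘ suc ∘ suc) (h ∘ suc ∘ suc) m x (λ j lt → eq (2+ j) (s≤s (s≤s lt)))))

  kac : ℕ → ℕ → ℤ
  kac N j = + j * (+ N - + j)

  continuant-kac-suc : ∀ N m x →
    continuant (kac (suc N)) (suc m) x
      ≡ continuant (kac N) (suc m) (x + 1ℤ) - + suc m * continuant (kac N) m (x + 1ℤ)
  continuant-kac-suc N zero       x = base₀ x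
    where
    base₀ : ∀ x → x ≡ (x + 1ℤ) - 1ℤ * 1ℤ
    base₀ = solve-∀
  continuant-kac-suc N (suc zero) x = base₁ x (+ N)
    where
    base₁ : ∀ x n → x * x - (1ℤ * ((1ℤ + n) - 1ℤ)) * 1ℤ
                  ≡ (x + 1ℤ) * (x + 1ℤ) - (1ℤ * (n - 1ℤ)) * 1ℤ - (1ℤ + 1ℤ) * (x + 1ℤ)
    base₁ = solve-∀
  continuant-kac-suc N (suc (suc m)) x = begin
    continuant (kac (suc N)) (suc (2+ m)) x
      ≡⟨ continuant-last (kac (suc N)) (suc m) x ⟩
    x * continuant (kac (suc N)) (2+ m) x - kac (suc N) (2+ m) * continuant (kac (suc N)) (suc m) x
      ≡⟨ cong₂ (λ u v → x * u - kac (suc N) (2+ m) * v)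
               (continuant-kac-suc N (suc m) x) (continuant-kac-suc N m x) ⟩
    x * (A (2+ m) - + (2+ m) * A (suc m)) - kac (suc N) (2+ m) * (A (suc m) - + (suc m) * A m)
      ≡⟨ cong (λ u → x * (u - + (2+ m) * A (suc m)) - kac (suc N) (2+ m) * (A (suc m) - + (suc m) * A m))
              (continuant-last (kac N) m (x + 1ℤ)) ⟩
    x * (A₂ - + (2+ m) * A (suc m)) - kac (suc N) (2+ m) * (A (suc m) - + (suc m) * A m)
      ≡⟨ rearrange x (+ N) (+ m) (A (suc m)) (A m) ⟩
    ((x + 1ℤ) * A₂ - kac N (2+ m) * A (suc m)) - + (suc (2+ m)) * A₂
      ≡⟨ cong₂ (λ u v → u - + (suc (2+ m)) * v)
               (sym (trans (continuant-last (kac N) (suc m) (x + 1ℤ))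
                           (cong (λ u → (x + 1ℤ) * u - kac N (2+ m) * A (suc m))
                                 (continuant-last (kac N) m (x + 1ℤ)))))
               (sym (continuant-last (kac N) m (x + 1ℤ))) ⟩
    A (suc (2+ m)) - + (suc (2+ m)) * A (2+ m) ∎
    where
    A : ℕ → ℤ
    A j = continuant (kac N) j (x + 1ℤ)
    A₂ : ℤ
    A₂ = (x + 1ℤ) * A (suc m) - kac N (suc m) * A m
    rearrange : ∀ x n m a₁ a₀ →
      let m₁ = 1ℤ + m
          m₂ = 1ℤ + m₁
          a₂ = (x + 1ℤ) * a₁ - (m₁ * (n - m₁)) * a₀
      in x * (a₂ - m₂ * a₁) - (m₂ * ((1ℤ + n) - m₂)) * (a₁ - m₁ * a₀)
           ≡ ((x + 1ℤ) * a₂ - (m₂ * (n - m₂)) * a₁) - (1ℤ + m₂) * a₂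
    rearrange = solve-∀

  -- ∏_{i < N} (x − (N − 1) + 2i)
  kacProduct : ℕ → ℤ → ℤ
  kacProduct zero          x = 1ℤ
  kacProduct (suc zero)    x = x
  kacProduct (suc (suc N)) x = (x * x - + suc N * + suc N) * kacProduct N x

  kacProduct-suc : ∀ N x → kacProduct (suc N) x ≡ (x - + N) * kacProduct N (x + 1ℤ)
  kacProduct-suc zero          x = base₀ x
    where
    base₀ : ∀ x → x ≡ (x - 0ℤ) * 1ℤ
    base₀ = solve-∀
  kacProduct-suc (suc zero)    x = base₁ x
    where
    base₁ : ∀ x → (x * x - 1ℤ * 1ℤ) * 1ℤ ≡ (x - 1ℤ) * (x + 1ℤ)
    base₁ = solve-∀
  kacProduct-suc (suc (suc N)) x =
    trans (cong ((x * x - + 2+ N * + 2+ N) *_) (kacProduct-suc N x))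
          (regroup x (+ N) (kacProduct N (x + 1ℤ)))
    where
    regroup : ∀ x n p → (x * x - (1ℤ + (1ℤ + n)) * (1ℤ + (1ℤ + n))) * ((x - n) * p)
                      ≡ (x - (1ℤ + (1ℤ + n))) * (((x + 1ℤ) * (x + 1ℤ) - (1ℤ + n) * (1ℤ + n)) * p)
    regroup = solve-∀

  -- The weight kac N N vanishes, so the last expansion step degenerates.
  continuant-kac-top : ∀ N y → continuant (kac N) (suc N) y ≡ y * continuant (kac N) N y
  continuant-kac-top zero    y = sym (*-identityʳ y)
  continuant-kac-top (suc N) y =
    trans (continuant-last (kac (suc N)) N y) (drop y (+ suc N) _ _)
    where
    drop : ∀ y a q₁ q₀ → y * q₁ - (a * (a - a)) * q₀ ≡ y * q₁
    drop = solve-∀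

  continuant-kac : ∀ N x → continuant (kac N) N x ≡ kacProduct N x
  continuant-kac zero    x = refl
  continuant-kac (suc N) x = begin
    continuant (kac (suc N)) (suc N) x
      ≡⟨ continuant-kac-suc N N x ⟩
    continuant (kac N) (suc N) (x + 1ℤ) - + suc N * continuant (kac N) N (x + 1ℤ)
      ≡⟨ cong (_- + suc N * continuant (kac N) N (x + 1ℤ)) (continuant-kac-top N (x + 1ℤ)) ⟩
    (x + 1ℤ) * continuant (kac N) N (x + 1ℤ) - + suc N * continuant (kac N) N (x + 1ℤ)
      ≡⟨ factor x (+ N) _ ⟩
    (x - + N) * continuant (kac N) N (x + 1ℤ)
      ≡⟨ cong ((x - + N) *_) (continuant-kac N (x + 1ℤ)) ⟩
    (x - + N) * kacProduct N (x + 1ℤ)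
      ≡⟨ kacProduct-suc N x ⟨
    kacProduct (suc N) x ∎
    where
    factor : ∀ x n q → (x + 1ℤ) * q - (1ℤ + n) * q ≡ (x - n) * q
    factor = solve-∀

  -- Σ_{2k ≤ m} c k · x ^ (m − 2k)
  lacunary : ℕ → (ℕ → ℤ) → ℤ → ℤ
  lacunary zero          c x = c 0
  lacunary (suc zero)    c x = c 0 * x
  lacunary (suc (suc m)) c x = c 0 * x ^ (2+ m) + lacunary m (c ∘ suc) x

  lacunary-cong : ∀ m c d x → (∀ k → c k ≡ d k) → lacunary m c x ≡ lacunary m d x
  lacunary-cong zero          c d x eq = eq 0
  lacunary-cong (suc zero)    c d x eq = cong (_* x) (eq 0)
  lacunary-cong (suc (suc m)) c d x eq =
    cong₂ (λ u v → u * x ^ (2+ m) + v) (eq 0) (lacunary-cong m (c ∘ suc) (d ∘ suc) x (eq ∘ suc))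

  lacunary-linear : ∀ m c d a x →
    lacunary m c x - a * lacunary m d x ≡ lacunary m (λ k → c k - a * d k) x
  lacunary-linear zero          c d a x = refl
  lacunary-linear (suc zero)    c d a x = distrib (c 0) (d 0) a x
    where
    distrib : ∀ c d a x → c * x - a * (d * x) ≡ (c - a * d) * x
    distrib = solve-∀
  lacunary-linear (suc (suc m)) c d a x =
    trans (distrib (c 0) (d 0) a (x ^ (2+ m)) _ _)
          (cong (λ u → (c 0 - a * d 0) * x ^ (2+ m) + u) (lacunary-linear m (c ∘ suc) (d ∘ suc) a x))
    where
    distrib : ∀ c d a p u v → (c * p + u) - a * (d * p + v) ≡ (c - a * d) * p + (u - a * v)
    distrib = solve-∀

  delay : (ℕ → ℤ) → ℕ → ℤ
  delay c zero    = 0ℤ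
  delay c (suc k) = c k

  lacunary-delay : ∀ m c x → lacunary m c x ≡ lacunary (2+ m) (delay c) x
  lacunary-delay m c x = sym (trans (cong (_+ lacunary m c x) (*-zeroˡ (x ^ (2+ m)))) (+-identityˡ _))

  -- For odd m the product gains the term of index (m + 1) / 2, whose coefficient must vanish.
  *-lacunary : ∀ m c x → (∀ k → m < k ℕ.+ k → c k ≡ 0ℤ) → x * lacunary m c x ≡ lacunary (suc m) c x
  *-lacunary zero          c x _   = *-comm x (c 0)
  *-lacunary (suc zero)    c x top = begin
    x * (c 0 * x)             ≡⟨ square-out x (c 0) ⟩
    c 0 * x ^ 2 + 0ℤ          ≡⟨ cong (λ u → c 0 * x ^ 2 + u) (top 1 (s≤s (s≤s z≤n))) ⟨
    c 0 * x ^ 2 + c 1         ∎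
    where
    square-out : ∀ x c → x * (c * x) ≡ c * (x * (x * 1ℤ)) + 0ℤ
    square-out = solve-∀
  *-lacunary (suc (suc m)) c x top =
    trans (distrib x (c 0) (x ^ (2+ m)) (lacunary m (c ∘ suc) x))
          (cong (λ u → c 0 * x ^ suc (2+ m) + u) (*-lacunary m (c ∘ suc) x top′))
    where
    distrib : ∀ x c p u → x * (c * p + u) ≡ c * (x * p) + x * u
    distrib = solve-∀
    top′ : ∀ k → m < k ℕ.+ k → c (suc k) ≡ 0ℤ
    top′ k lt = top (suc k) (subst (2+ m <_) (sym (ℕ.+-suc (suc k) k)) (s≤s (s≤s lt)))

  lacunary-recurrence : ∀ m a b c x → (∀ k → suc m < k ℕ.+ k → a k ≡ 0ℤ) →
    x * lacunary (suc m) a x - c * lacunary m b x ≡ lacunary (2+ m) (λ k → a k - c * delay b k) x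
  lacunary-recurrence m a b c x top =
    trans (cong₂ (λ u v → u - c * v) (*-lacunary (suc m) a x top) (lacunary-delay m b x))
          (lacunary-linear (2+ m) a (delay b) c x)

  signed : ℕ → ℤ → ℤ
  signed zero    z = z
  signed (suc k) z = - signed k z

  signed-zero : ∀ k → signed k 0ℤ ≡ 0ℤ
  signed-zero zero    = refl
  signed-zero (suc k) = cong -_ (signed-zero k)

  signed-injective : ∀ k {u v} → signed k u ≡ signed k v → u ≡ v
  signed-injective zero    eq = eq
  signed-injective (suc k) eq = signed-injective k (neg-injective eq)

  signed-step : ∀ k u v c → signed (suc k) u - c * signed k v ≡ signed (suc k) (u + c * v)
  signed-step zero    u v c = base u v c
    where
    base : ∀ u v c → - u - c * v ≡ - (u + c * v)
    base = solve-∀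
  signed-step (suc k) u v c =
    trans (step (signed (suc k) u) (signed k v) c) (cong -_ (signed-step k u v c))
    where
    step : ∀ s t c → - s - c * (- t) ≡ - (s - c * t)
    step = solve-∀

  signed-recurrence : ∀ (A B C : ℕ → ℕ) c → A 0 ≡ C 0 →
    (∀ k → C (suc k) ≡ A (suc k) ℕ.+ c ℕ.* B k) →
    ∀ k → signed k (+ A k) - + c * delay (λ i → signed i (+ B i)) k ≡ signed k (+ C k)
  signed-recurrence A B C c eq₀ eq zero    =
    trans (cong (λ u → + A 0 + u) (cong -_ (*-zeroʳ (+ c)))) (trans (+-identityʳ _) (cong +_ eq₀))
  signed-recurrence A B C c eq₀ eq (suc k) = begin
    signed (suc k) (+ A (suc k)) - + c * signed k (+ B k)   ≡⟨ signed-step k (+ A (suc k)) (+ B k) (+ c) ⟩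
    signed (suc k) (+ A (suc k) + + c * + B k)              ≡⟨ cong (signed (suc k)) lift ⟩
    signed (suc k) (+ C (suc k))                            ∎
    where
    lift : + A (suc k) + + c * + B k ≡ + C (suc k)
    lift = begin
      + A (suc k) + + c * + B k         ≡⟨ cong (λ u → + A (suc k) + u) (pos-* c (B k)) ⟨
      + A (suc k) + + (c ℕ.* B k)       ≡⟨ pos-+ (A (suc k)) (c ℕ.* B k) ⟨
      + (A (suc k) ℕ.+ c ℕ.* B k)       ≡⟨ cong +_ (eq k) ⟨
      + C (suc k)                       ∎

  continuant-coefficients : ∀ g e x →
    continuant (+_ ∘ g) (suc e) x ≡ lacunary (suc e) (λ k → signed k (+ indep g e k)) x
  continuant-coefficients g zero          x = sym (*-identityˡ x)
  continuant-coefficients g (suc zero)    x = expand x (+ g 1)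
    where
    expand : ∀ x a → x * x - a * 1ℤ ≡ 1ℤ * (x * (x * 1ℤ)) + - a
    expand = solve-∀
  continuant-coefficients g (suc (suc e)) x = begin
    x * continuant (+_ ∘ g ∘ suc) (2+ e) x - + g 1 * continuant (+_ ∘ g ∘ suc ∘ suc) (suc e) x
      ≡⟨ cong₂ (λ u v → x * u - + g 1 * v) (continuant-coefficients (g ∘ suc) (suc e) x)
                                            (continuant-coefficients (g ∘ suc ∘ suc) e x) ⟩
    x * lacunary (2+ e) a x - + g 1 * lacunary (suc e) b x
      ≡⟨ lacunary-recurrence (suc e) a b (+ g 1) x top ⟩
    lacunary (suc (2+ e)) (λ k → a k - + g 1 * delay b k) x
      ≡⟨ lacunary-cong (suc (2+ e)) _ _ x
           (signed-recurrence (indep (g ∘ suc) (suc e)) (indep (g ∘ suc ∘ suc) e) (indep g (2+ e)) (g 1)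
                              refl (λ k → refl)) ⟩
    lacunary (suc (2+ e)) (λ k → signed k (+ indep g (2+ e) k)) x ∎
    where
    a b : ℕ → ℤ
    a k = signed k (+ indep (g ∘ suc) (suc e) k)
    b k = signed k (+ indep (g ∘ suc ∘ suc) e k)
    top : ∀ k → 2+ e < k ℕ.+ k → a k ≡ 0ℤ
    top k lt = trans (cong (signed k ∘ +_) (indep-vanish (g ∘ suc) (suc e) k lt)) (signed-zero k)

  kacProduct-coefficients : ∀ n x →
    kacProduct (suc n) x ≡ lacunary (suc n) (λ k → signed k (+ squareEsym n k)) x
  kacProduct-coefficients zero          x = sym (*-identityˡ x)
  kacProduct-coefficients (suc zero)    x = expand x
    where
    expand : ∀ x → (x * x - 1ℤ * 1ℤ) * 1ℤ ≡ 1ℤ * (x * (x * 1ℤ)) + - 1ℤ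
    expand = solve-∀
  kacProduct-coefficients (suc (suc n)) x = begin
    (x * x - c) * kacProduct (suc n) x
      ≡⟨ cong ((x * x - c) *_) (kacProduct-coefficients n x) ⟩
    (x * x - c) * lacunary (suc n) a x
      ≡⟨ distrib x c (lacunary (suc n) a x) ⟩
    x * (x * lacunary (suc n) a x) - c * lacunary (suc n) a x
      ≡⟨ cong (λ u → x * u - c * lacunary (suc n) a x) (*-lacunary (suc n) a x top) ⟩
    x * lacunary (2+ n) a x - c * lacunary (suc n) a x
      ≡⟨ lacunary-recurrence (suc n) a a c x (λ k lt → top k (ℕ.<-trans (ℕ.n<1+n _) lt)) ⟩
    lacunary (suc (2+ n)) (λ k → a k - c * delay a k) x
      ≡⟨ lacunary-cong (suc (2+ n)) _ _ x
           (subst (λ c′ → ∀ k → a k - c′ * delay a k ≡ signed k (+ squareEsym (2+ n) k))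
                  (pos-* (2+ n) (2+ n))
                  (signed-recurrence (squareEsym n) (squareEsym n) (squareEsym (2+ n)) (square (2+ n))
                                     refl (squareEsym-step n))) ⟩
    lacunary (suc (2+ n)) (λ k → signed k (+ squareEsym (2+ n) k)) x ∎
    where
    c : ℤ
    c = + 2+ n * + 2+ n
    a : ℕ → ℤ
    a k = signed k (+ squareEsym n k)
    top : ∀ k → suc n < k ℕ.+ k → a k ≡ 0ℤ
    top k lt = trans (cong (signed k ∘ +_) (squareEsym-vanish n k lt)) (signed-zero k)
    distrib : ∀ x c p → (x * x - c) * p ≡ x * (x * p) - c * p
    distrib = solve-∀

  double : ℕ → ℕ
  double zero    = zero
  double (suc j) = 2+ (double j)

  lacunary-odd : ∀ j d x → lacunary (suc (double j)) d x ≡ x * lacunary (double j) d x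
  lacunary-odd zero    d x = *-comm (d 0) x
  lacunary-odd (suc j) d x =
    trans (cong (λ u → d 0 * x ^ suc (double (suc j)) + u) (lacunary-odd j (d ∘ suc) x))
          (factor x (d 0) (x ^ double (suc j)) (lacunary (double j) (d ∘ suc) x))
    where
    factor : ∀ x c p u → c * (x * p) + x * u ≡ x * (c * p + u)
    factor = solve-∀

  lacunary-even : ∀ j d x → lacunary (double (suc j)) d x ≡ x * x * lacunary (double j) d x + d (suc j)
  lacunary-even zero    d x = factor x (d 0) (d 1)
    where
    factor : ∀ x c₀ c₁ → c₀ * (x * (x * 1ℤ)) + c₁ ≡ x * x * c₀ + c₁
    factor = solve-∀
  lacunary-even (suc j) d x =
    trans (cong (λ u → d 0 * x ^ double (2+ j) + u) (lacunary-even j (d ∘ suc) x))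
          (factor x (d 0) (x ^ double (suc j)) (lacunary (double j) (d ∘ suc) x) (d (2+ j)))
    where
    factor : ∀ x c p u t → c * (x * (x * p)) + (x * x * u + t) ≡ x * x * (c * p + u) + t
    factor = solve-∀

  m∣m*n : ∀ m n → m ∣ m * n
  m∣m*n m n = divides ∣ n ∣ (trans (abs-* m n) (ℕ.*-comm ∣ m ∣ ∣ n ∣))

  divisible-by-all⇒0 : ∀ d → (∀ y → + suc y ∣ d) → d ≡ 0ℤ
  divisible-by-all⇒0 d div with ∣ d ∣ in abs-d | div ∣ d ∣
  ... | zero  | _       = ∣i∣≡0⇒i≡0 abs-d
  ... | suc a | a+2∣a+1 = ⊥-elim (>⇒∤ (ℕ.n<1+n (suc a)) a+2∣a+1)

  -- The lowest coefficient is divisible by every positive integer, hence zero.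
  lacunary-lowest-zero : ∀ j d → (∀ y → lacunary (double (suc j)) d (+ suc y) ≡ 0ℤ) → d (suc j) ≡ 0ℤ
  lacunary-lowest-zero j d zero-at = divisible-by-all⇒0 (d (suc j)) λ y →
    subst (+ suc y ∣_) (sym (lowest≡ (+ suc y) (zero-at y)))
          (m∣m*n (+ suc y) (- (+ suc y * lacunary (double j) d (+ suc y))))
    where
    lowest≡ : ∀ x → lacunary (double (suc j)) d x ≡ 0ℤ → d (suc j) ≡ x * - (x * lacunary (double j) d x)
    lowest≡ x vanishes = begin
      d (suc j)
        ≡⟨ cancel x l (d (suc j)) ⟨
      (x * x * l + d (suc j)) - x * x * l
        ≡⟨ cong (_- x * x * l) (trans (sym (lacunary-even j d x)) vanishes) ⟩
      0ℤ - x * x * l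
        ≡⟨ regroup x l ⟩
      x * - (x * l) ∎
      where
      l : ℤ
      l = lacunary (double j) d x
      cancel : ∀ x l t → (x * x * l + t) - x * x * l ≡ t
      cancel = solve-∀
      regroup : ∀ x l → 0ℤ - x * x * l ≡ x * - (x * l)
      regroup = solve-∀

  lacunary-zero-double : ∀ j d → (∀ y → lacunary (double j) d (+ suc y) ≡ 0ℤ) →
                         ∀ k → k ≤ j → d k ≡ 0ℤ
  lacunary-zero-double zero    d zero-at zero z≤n = zero-at 0
  lacunary-zero-double (suc j) d zero-at k k≤j+1 with ℕ.m≤n⇒m<n∨m≡n k≤j+1
  ... | inj₂ refl = lacunary-lowest-zero j d zero-at
  ... | inj₁ k≤j  = lacunary-zero-double j d lower-zero k (ℕ.≤-pred k≤j)
    where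
    lower-zero : ∀ y → lacunary (double j) d (+ suc y) ≡ 0ℤ
    lower-zero y = *-cancelˡ-≡ (+ suc y) _ _ (*-cancelˡ-≡ (+ suc y) _ _ (drop-lowest (+ suc y) (zero-at y)))
      where
      drop-lowest : ∀ x → lacunary (double (suc j)) d x ≡ 0ℤ →
                    x * (x * lacunary (double j) d x) ≡ x * (x * 0ℤ)
      drop-lowest x vanishes = begin
        x * (x * l)                     ≡⟨ reassoc x l ⟩
        x * x * l + 0ℤ                  ≡⟨ cong (λ u → x * x * l + u) (lacunary-lowest-zero j d zero-at) ⟨
        x * x * l + d (suc j)           ≡⟨ lacunary-even j d x ⟨
        lacunary (double (suc j)) d x   ≡⟨ vanishes ⟩
        0ℤ                              ≡⟨ zeros x ⟩
        x * (x * 0ℤ)                    ∎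
        where
        l : ℤ
        l = lacunary (double j) d x
        reassoc : ∀ x l → x * (x * l) ≡ x * x * l + 0ℤ
        reassoc = solve-∀
        zeros : ∀ x → 0ℤ ≡ x * (x * 0ℤ)
        zeros = solve-∀

  halve-≤ : ∀ k j → k ℕ.+ k ≤ suc (double j) → k ≤ j
  halve-≤ zero    j       _  = z≤n
  halve-≤ (suc k) zero    le rewrite ℕ.+-suc k k with le
  ... | s≤s ()
  halve-≤ (suc k) (suc j) le rewrite ℕ.+-suc k k = s≤s (halve-≤ k j (ℕ.≤-pred (ℕ.≤-pred le)))

  double-or-odd : ∀ m → Σ ℕ λ j → m ≡ double j ⊎ m ≡ suc (double j)
  double-or-odd zero = 0 , inj₁ refl
  double-or-odd (suc m) with double-or-odd m
  ... | j , inj₁ refl = j , inj₂ refl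
  ... | j , inj₂ refl = suc j , inj₁ refl

  lacunary-zero : ∀ m d → (∀ y → lacunary m d (+ suc y) ≡ 0ℤ) → ∀ k → k ℕ.+ k ≤ m → d k ≡ 0ℤ
  lacunary-zero m d zero-at k le with double-or-odd m
  ... | j , inj₁ refl = lacunary-zero-double j d zero-at k (halve-≤ k j (ℕ.m≤n⇒m≤1+n le))
  ... | j , inj₂ refl = lacunary-zero-double j d even-zero k (halve-≤ k j le)
    where
    even-zero : ∀ y → lacunary (double j) d (+ suc y) ≡ 0ℤ
    even-zero y = *-cancelˡ-≡ (+ suc y) _ _
      (trans (sym (lacunary-odd j d (+ suc y))) (trans (zero-at y) (sym (*-zeroʳ (+ suc y)))))

  lacunary-injective : ∀ m c d → (∀ y → lacunary m c (+ suc y) ≡ lacunary m d (+ suc y)) →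
                       ∀ k → k ℕ.+ k ≤ m → c k ≡ d k
  lacunary-injective m c d agree k le =
    trans (sym (shift (c k) (d k)))
          (trans (cong (_+ d k) (lacunary-zero m (λ i → c i - 1ℤ * d i) difference-zero k le))
                 (+-identityˡ (d k)))
    where
    shift : ∀ c d → (c - 1ℤ * d) + d ≡ c
    shift = solve-∀
    cancel : ∀ l → l - 1ℤ * l ≡ 0ℤ
    cancel = solve-∀
    difference-zero : ∀ y → lacunary m (λ i → c i - 1ℤ * d i) (+ suc y) ≡ 0ℤ
    difference-zero y = begin
      lacunary m (λ i → c i - 1ℤ * d i) (+ suc y)
        ≡⟨ lacunary-linear m c d 1ℤ (+ suc y) ⟨
      lacunary m c (+ suc y) - 1ℤ * lacunary m d (+ suc y)
        ≡⟨ cong (λ u → u - 1ℤ * lacunary m d (+ suc y)) (agree y) ⟩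
      lacunary m d (+ suc y) - 1ℤ * lacunary m d (+ suc y)
        ≡⟨ cancel (lacunary m d (+ suc y)) ⟩
      0ℤ ∎

  kacWeight-ℤ : ∀ N j → j ≤ N → + kacWeight N j ≡ kac N j
  kacWeight-ℤ N j j≤N = trans (pos-* j (N ℕ.∸ j))
    (cong (+ j *_) (sym (trans ([+m]-[+n]≡m⊖n N j) (⊖-≥ j≤N))))

  squareEsym≡indep-kacWeight : ∀ n k → squareEsym n k ≡ indep (kacWeight (suc n)) n k
  squareEsym≡indep-kacWeight n k with k ℕ.+ k ℕ.≤? suc n
  ... | no  k+k≰n+1 = trans (squareEsym-vanish n k lt) (sym (indep-vanish (kacWeight (suc n)) n k lt))
    where
    lt : suc n < k ℕ.+ k
    lt = ℕ.≰⇒> k+k≰n+1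
  ... | yes k+k≤n+1 = sym (+-injective (signed-injective k
          (lacunary-injective (suc n) _ _ (same-polynomial ∘ +_ ∘ suc) k k+k≤n+1)))
    where
    same-polynomial : ∀ x → lacunary (suc n) (λ i → signed i (+ indep (kacWeight (suc n)) n i)) x
                          ≡ lacunary (suc n) (λ i → signed i (+ squareEsym n i)) x
    same-polynomial x = begin
      lacunary (suc n) (λ i → signed i (+ indep (kacWeight (suc n)) n i)) x
        ≡⟨ continuant-coefficients (kacWeight (suc n)) n x ⟨
      continuant (+_ ∘ kacWeight (suc n)) (suc n) x
        ≡⟨ continuant-cong _ _ (suc n) x (λ j j<n+1 → kacWeight-ℤ (suc n) (suc j) j<n+1) ⟩
      continuant (kac (suc n)) (suc n) x
        ≡⟨ continuant-kac (suc n) x ⟩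
      kacProduct (suc n) x
        ≡⟨ kacProduct-coefficients n x ⟩
      lacunary (suc n) (λ i → signed i (+ squareEsym n i)) x ∎

module SubsetSums where

  open WeightedCounts
  open import Data.Bool using (Bool; true; false; _∧_; not)
  import Data.Integer as ℤ
  open import Data.Bool.Properties using (∧-zeroʳ)
  open import Data.Bool.ListAction using (all; and)
  open import Data.Fin using (Fin) renaming (zero to fzero; suc to fsuc)
  open import Data.List using (List; []; _∷_; map; _++_; length; filterᵇ; allFin; tabulate)
  open import Data.List.Properties using (length-map; map-∘; map-cong; map-tabulate)
  open import Data.Nat
  open import Data.Nat.ListAction using (sum; product)
  open import Data.Nat.Properties
  open import Data.Vec using (_∷_)
  open import Algebra.Properties.CommutativeSemigroup *-commutativeSemigroup using (x∙yz≈y∙xz)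
  open ≡-Reasoning

  sumWhen : {A : Set} → (A → Bool) → (A → ℕ) → List A → ℕ
  sumWhen P f []       = 0
  sumWhen P f (x ∷ xs) = 𝟙 (P x) * f x + sumWhen P f xs

  sum-map-filterᵇ : ∀ {A : Set} (P : A → Bool) f xs → sum (map f (filterᵇ P xs)) ≡ sumWhen P f xs
  sum-map-filterᵇ P f []       = refl
  sum-map-filterᵇ P f (x ∷ xs) with P x
  ... | true  = cong₂ _+_ (sym (+-identityʳ (f x))) (sum-map-filterᵇ P f xs)
  ... | false = sum-map-filterᵇ P f xs

  sumWhen-++ : ∀ {A : Set} (P : A → Bool) f xs ys →
               sumWhen P f (xs ++ ys) ≡ sumWhen P f xs + sumWhen P f ys
  sumWhen-++ P f []       ys = refl
  sumWhen-++ P f (x ∷ xs) ys =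
    trans (cong (𝟙 (P x) * f x +_) (sumWhen-++ P f xs ys)) (sym (+-assoc (𝟙 (P x) * f x) _ _))

  sumWhen-map : ∀ {A B : Set} (P : B → Bool) f (g : A → B) xs →
                sumWhen P f (map g xs) ≡ sumWhen (P ∘ g) (f ∘ g) xs
  sumWhen-map P f g []       = refl
  sumWhen-map P f g (x ∷ xs) = cong (𝟙 (P (g x)) * f (g x) +_) (sumWhen-map P f g xs)

  sumWhen-cong : ∀ {A : Set} {P Q : A → Bool} {f g : A → ℕ} xs →
                 (∀ x → P x ≡ Q x) → (∀ x → f x ≡ g x) → sumWhen P f xs ≡ sumWhen Q g xs
  sumWhen-cong []       P≡Q f≡g = refl
  sumWhen-cong (x ∷ xs) P≡Q f≡g =
    cong₂ _+_ (cong₂ _*_ (cong 𝟙 (P≡Q x)) (f≡g x)) (sumWhen-cong xs P≡Q f≡g)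

  sumWhen-none : ∀ {A : Set} (P : A → Bool) f xs → (∀ x → P x ≡ false) → sumWhen P f xs ≡ 0
  sumWhen-none P f []       none = refl
  sumWhen-none P f (x ∷ xs) none rewrite none x = sumWhen-none P f xs none

  sumWhen-*ˡ : ∀ {A : Set} (P : A → Bool) f c xs → sumWhen P (λ x → c * f x) xs ≡ c * sumWhen P f xs
  sumWhen-*ˡ P f c []       = sym (*-zeroʳ c)
  sumWhen-*ˡ P f c (x ∷ xs) = begin
    𝟙 (P x) * (c * f x) + sumWhen P (λ x → c * f x) xs
      ≡⟨ cong (𝟙 (P x) * (c * f x) +_) (sumWhen-*ˡ P f c xs) ⟩
    𝟙 (P x) * (c * f x) + c * sumWhen P f xs
      ≡⟨ cong (_+ c * sumWhen P f xs) (x∙yz≈y∙xz (𝟙 (P x)) c (f x)) ⟩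
    c * (𝟙 (P x) * f x) + c * sumWhen P f xs
      ≡⟨ *-distribˡ-+ c (𝟙 (P x) * f x) _ ⟨
    c * (𝟙 (P x) * f x + sumWhen P f xs) ∎

  filterᵇ-map : ∀ {A B : Set} (p : B → Bool) (f : A → B) xs →
                filterᵇ p (map f xs) ≡ map f (filterᵇ (p ∘ f) xs)
  filterᵇ-map p f []       = refl
  filterᵇ-map p f (x ∷ xs) with p (f x)
  ... | true  = cong (f x ∷_) (filterᵇ-map p f xs)
  ... | false = filterᵇ-map p f xs

  elements : ∀ {n} → Sub n → List ℕ
  elements J = map elt (members J)

  members-tail : ∀ {n} b (J : Sub n) →
                 filterᵇ (_∈ᵇ (b ∷ J)) (tabulate fsuc) ≡ map fsuc (members J)
  members-tail {n} b J = trans (cong (filterᵇ (_∈ᵇ (b ∷ J))) (sym (map-tabulate (λ i → i) fsuc)))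
                               (filterᵇ-map (_∈ᵇ (b ∷ J)) fsuc (allFin n))

  map-elt-fsuc : ∀ {n} (is : List (Fin n)) → map elt (map fsuc is) ≡ map suc (map elt is)
  map-elt-fsuc is = trans (sym (map-∘ is)) (map-∘ is)

  withOne : List ℕ → List ℕ
  withOne vs = 1 ∷ map suc vs

  elements-true : ∀ {n} (J : Sub n) → elements (true ∷ J) ≡ withOne (elements J)
  elements-true J =
    trans (cong (λ is → 1 ∷ map elt is) (members-tail true J)) (cong (1 ∷_) (map-elt-fsuc (members J)))

  elements-false : ∀ {n} (J : Sub n) → elements (false ∷ J) ≡ map suc (elements J)
  elements-false J = trans (cong (map elt) (members-tail false J)) (map-elt-fsuc (members J))

  subsetSum : (n : ℕ) → (List ℕ → Bool) → (List ℕ → ℕ) → ℕ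
  subsetSum n Φ G = sumWhen (Φ ∘ elements) (G ∘ elements) (allSubsets n)

  sumOver-subsetSum : ∀ n P f Φ G → (∀ J → P J ≡ Φ (elements J)) → (∀ J → f J ≡ G (elements J)) →
                      sumOver n P f ≡ subsetSum n Φ G
  sumOver-subsetSum n P f Φ G P≡Φ f≡G =
    trans (sum-map-filterᵇ P f (allSubsets n)) (sumWhen-cong (allSubsets n) P≡Φ f≡G)

  subsetSum-cong : ∀ n Φ Ψ G H → (∀ (J : Sub n) → Φ (elements J) ≡ Ψ (elements J)) →
                   (∀ (J : Sub n) → G (elements J) ≡ H (elements J)) → subsetSum n Φ G ≡ subsetSum n Ψ H
  subsetSum-cong n Φ Ψ G H = sumWhen-cong (allSubsets n)

  subsetSum-none : ∀ n Φ G → (∀ (J : Sub n) → Φ (elements J) ≡ false) → subsetSum n Φ G ≡ 0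
  subsetSum-none n Φ G = sumWhen-none (Φ ∘ elements) (G ∘ elements) (allSubsets n)

  subsetSum-*ˡ : ∀ n Φ G c → subsetSum n Φ (λ vs → c * G vs) ≡ c * subsetSum n Φ G
  subsetSum-*ˡ n Φ G c = sumWhen-*ˡ (Φ ∘ elements) (G ∘ elements) c (allSubsets n)

  subsetSum-suc : ∀ n Φ G → subsetSum (suc n) Φ G
    ≡ subsetSum n (Φ ∘ withOne) (G ∘ withOne) + subsetSum n (Φ ∘ map suc) (G ∘ map suc)
  subsetSum-suc n Φ G = begin
    sumWhen (Φ ∘ elements) (G ∘ elements) (map (true ∷_) (allSubsets n) ++ map (false ∷_) (allSubsets n))
      ≡⟨ sumWhen-++ (Φ ∘ elements) (G ∘ elements) (map (true ∷_) (allSubsets n)) _ ⟩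
    sumWhen (Φ ∘ elements) (G ∘ elements) (map (true ∷_) (allSubsets n))
      + sumWhen (Φ ∘ elements) (G ∘ elements) (map (false ∷_) (allSubsets n))
      ≡⟨ cong₂ _+_ (sumWhen-map (Φ ∘ elements) (G ∘ elements) (true ∷_) (allSubsets n))
                   (sumWhen-map (Φ ∘ elements) (G ∘ elements) (false ∷_) (allSubsets n)) ⟩
    sumWhen (Φ ∘ elements ∘ (true ∷_)) (G ∘ elements ∘ (true ∷_)) (allSubsets n)
      + sumWhen (Φ ∘ elements ∘ (false ∷_)) (G ∘ elements ∘ (false ∷_)) (allSubsets n)
      ≡⟨ cong₂ _+_ (sumWhen-cong (allSubsets n) (cong Φ ∘ elements-true) (cong G ∘ elements-true))
                   (sumWhen-cong (allSubsets n) (cong Φ ∘ elements-false) (cong G ∘ elements-false)) ⟩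
    subsetSum n (Φ ∘ withOne) (G ∘ withOne) + subsetSum n (Φ ∘ map suc) (G ∘ map suc) ∎

  sized : ℕ → (List ℕ → Bool) → List ℕ → Bool
  sized k P vs = (length vs ≡ᵇ k) ∧ P vs

  weight : (ℕ → ℕ) → List ℕ → ℕ
  weight g vs = product (map g vs)

  noConsecutive : List ℕ → Bool
  noConsecutive vs = all (λ a → all (λ b → not (b ≡ᵇ suc a)) vs) vs

  all-map : ∀ {A B : Set} (p : B → Bool) (f : A → B) xs → all p (map f xs) ≡ all (p ∘ f) xs
  all-map p f xs = cong and (sym (map-∘ xs))

  all-cong : ∀ {A : Set} {p q : A → Bool} → (∀ x → p x ≡ q x) → ∀ xs → all p xs ≡ all q xs
  all-cong p≡q xs = cong and (map-cong p≡q xs)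

  weight-shift : ∀ g vs → weight g (map suc vs) ≡ weight (g ∘ suc) vs
  weight-shift g vs = cong product (sym (map-∘ vs))

  sized-shift : ∀ k P Q vs → P (map suc vs) ≡ Q vs → sized k P (map suc vs) ≡ sized k Q vs
  sized-shift k P Q vs P≡Q = cong₂ _∧_ (cong (_≡ᵇ k) (length-map suc vs)) P≡Q

  subsetSum-shift : ∀ n k Q Q′ g → (∀ vs → Q (map suc vs) ≡ Q′ vs) →
    subsetSum n (sized k Q ∘ map suc) (weight g ∘ map suc) ≡ subsetSum n (sized k Q′) (weight (g ∘ suc))
  subsetSum-shift n k Q Q′ g Q≡Q′ =
    subsetSum-cong n (sized k Q ∘ map suc) (sized k Q′) (weight g ∘ map suc) (weight (g ∘ suc))
                   (λ J → sized-shift k Q Q′ (elements J) (Q≡Q′ (elements J)))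
                   (λ J → weight-shift g (elements J))

  subsetSum-esym : ∀ P g n k → subsetSum n (sized k (all P)) (weight g) ≡ esym P g n k
  subsetSum-esym P g zero    zero    = refl
  subsetSum-esym P g zero    (suc k) = refl
  subsetSum-esym P g (suc n) zero =
    trans (subsetSum-suc n (sized 0 (all P)) (weight g))
          (cong₂ _+_ (subsetSum-none n (sized 0 (all P) ∘ withOne) (weight g ∘ withOne)
                                     (λ _ → refl))
                     (trans (subsetSum-shift n 0 (all P) (all (P ∘ suc)) g (all-map P suc))
                            (subsetSum-esym (P ∘ suc) (g ∘ suc) n 0)))
  subsetSum-esym P g (suc n) (suc k) =
    trans (subsetSum-suc n (sized (suc k) (all P)) (weight g))
          (trans (+-comm (subsetSum n (Φ ∘ withOne) (weight g ∘ withOne))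
                         (subsetSum n (Φ ∘ map suc) (weight g ∘ map suc)))
                 (cong₂ _+_ without-1 (with-1 (P 1) refl)))
    where
    Φ : List ℕ → Bool
    Φ = sized (suc k) (all P)

    with-1 : ∀ b → P 1 ≡ b →
      subsetSum n (Φ ∘ withOne) (weight g ∘ withOne)
        ≡ 𝟙 b * (g 1 * esym (P ∘ suc) (g ∘ suc) n k)
    with-1 true  P1 = begin
      subsetSum n (Φ ∘ withOne) (weight g ∘ withOne)
        ≡⟨ subsetSum-cong n (Φ ∘ withOne) (sized k (all (P ∘ suc)))
                            (weight g ∘ withOne) (λ vs → g 1 * weight (g ∘ suc) vs)
             (λ J → sized-shift k (λ ws → P 1 ∧ all P ws) (all (P ∘ suc)) (elements J)
                      (cong₂ _∧_ P1 (all-map P suc (elements J))))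
             (λ J → cong (g 1 *_) (weight-shift g (elements J))) ⟩
      subsetSum n (sized k (all (P ∘ suc))) (λ vs → g 1 * weight (g ∘ suc) vs)
        ≡⟨ subsetSum-*ˡ n (sized k (all (P ∘ suc))) (weight (g ∘ suc)) (g 1) ⟩
      g 1 * subsetSum n (sized k (all (P ∘ suc))) (weight (g ∘ suc))
        ≡⟨ cong (g 1 *_) (subsetSum-esym (P ∘ suc) (g ∘ suc) n k) ⟩
      g 1 * esym (P ∘ suc) (g ∘ suc) n k
        ≡⟨ *-identityˡ _ ⟨
      1 * (g 1 * esym (P ∘ suc) (g ∘ suc) n k) ∎
    with-1 false P1 = subsetSum-none n (Φ ∘ withOne) (weight g ∘ withOne) λ J →
      trans (cong (λ b → (length (map suc (elements J)) ≡ᵇ k) ∧ (b ∧ all P (map suc (elements J)))) P1)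
            (∧-zeroʳ _)

    without-1 : subsetSum n (Φ ∘ map suc) (weight g ∘ map suc)
                  ≡ esym (P ∘ suc) (g ∘ suc) n (suc k)
    without-1 = trans (subsetSum-shift n (suc k) (all P) (all (P ∘ suc)) g (all-map P suc))
                      (subsetSum-esym (P ∘ suc) (g ∘ suc) n (suc k))

  all-true : ∀ {A : Set} (xs : List A) → all (λ _ → true) xs ≡ true
  all-true []       = refl
  all-true (x ∷ xs) = all-true xs

  elements-nonzero : ∀ {n} (J : Sub n) → all (λ b → not (b ≡ᵇ 0)) (elements J) ≡ true
  elements-nonzero J = trans (all-map _ elt (members J)) (all-true (members J))

  noConsecutive-shift : ∀ vs → noConsecutive (map suc vs) ≡ noConsecutive vs
  noConsecutive-shift vs =
    trans (all-map _ suc vs) (all-cong (λ a → all-map (λ b → not (b ≡ᵇ 2+ a)) suc vs) vs)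

  noConsecutive-1∷ : ∀ ws → noConsecutive (1 ∷ map suc ws) ≡ all (λ b → not (b ≡ᵇ 1)) ws ∧ noConsecutive ws
  noConsecutive-1∷ ws = cong₂ _∧_ (all-map (λ b → not (b ≡ᵇ 2)) suc ws) (begin
    all (λ a → all (λ b → not (b ≡ᵇ suc a)) (1 ∷ map suc ws)) (map suc ws)
      ≡⟨ all-map (λ a → all (λ b → not (b ≡ᵇ suc a)) (1 ∷ map suc ws)) suc ws ⟩
    all (λ a → all (λ b → not (b ≡ᵇ 2+ a)) (map suc ws)) ws
      ≡⟨ all-map (λ a → all (λ b → not (b ≡ᵇ suc a)) (map suc ws)) suc ws ⟨
    noConsecutive (map suc ws)
      ≡⟨ noConsecutive-shift ws ⟩
    noConsecutive ws ∎)

  subsetSum-indep : ∀ g e k → subsetSum e (sized k noConsecutive) (weight g) ≡ indep g e k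
  subsetSum-indep g zero          zero          = refl
  subsetSum-indep g zero          (suc k)       = refl
  subsetSum-indep g (suc zero)    zero          = refl
  subsetSum-indep g (suc zero)    (suc zero)    = trans (+-identityʳ _) (trans (*-identityˡ _) (*-identityʳ (g 1)))
  subsetSum-indep g (suc zero)    (2+ k)        = refl
  subsetSum-indep g (2+ e)        zero          =
    trans (subsetSum-suc (suc e) (sized 0 noConsecutive) (weight g))
          (cong₂ _+_ (subsetSum-none (suc e) (sized 0 noConsecutive ∘ withOne)
                                              (weight g ∘ withOne) (λ _ → refl))
                     (trans (subsetSum-shift (suc e) 0 noConsecutive noConsecutive g noConsecutive-shift)
                            (subsetSum-indep (g ∘ suc) (suc e) 0)))
  subsetSum-indep g (2+ e)        (suc k)       =
    trans (subsetSum-suc (suc e) Φ (weight g))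
          (trans (+-comm (subsetSum (suc e) (Φ ∘ withOne) (weight g ∘ withOne))
                         (subsetSum (suc e) (Φ ∘ map suc) (weight g ∘ map suc)))
                 (cong₂ _+_ (trans (subsetSum-shift (suc e) (suc k) noConsecutive noConsecutive g
                                                    noConsecutive-shift)
                                   (subsetSum-indep (g ∘ suc) (suc e) (suc k)))
                            with-1))
    where
    Φ : List ℕ → Bool
    Φ = sized (suc k) noConsecutive

    -- Once 1 is chosen, 2 is excluded.
    with-1 : subsetSum (suc e) (Φ ∘ withOne) (weight g ∘ withOne)
               ≡ g 1 * indep (g ∘ suc ∘ suc) e k
    with-1 = begin
      subsetSum (suc e) (Φ ∘ withOne) (weight g ∘ withOne)
        ≡⟨ subsetSum-suc e (Φ ∘ withOne) (weight g ∘ withOne) ⟩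
      subsetSum e (Φ ∘ withOne ∘ withOne) (weight g ∘ withOne ∘ withOne)
        + subsetSum e (Φ ∘ withOne ∘ map suc) (weight g ∘ withOne ∘ map suc)
        ≡⟨ cong (_+ subsetSum e (Φ ∘ withOne ∘ map suc) (weight g ∘ withOne ∘ map suc))
                (subsetSum-none e (Φ ∘ withOne ∘ withOne)
                                  (weight g ∘ withOne ∘ withOne) (λ J → ∧-zeroʳ _)) ⟩
      subsetSum e (Φ ∘ withOne ∘ map suc) (weight g ∘ withOne ∘ map suc)
        ≡⟨ subsetSum-cong e (Φ ∘ withOne ∘ map suc) (sized k noConsecutive)
                            (weight g ∘ withOne ∘ map suc) (λ vs → g 1 * weight (g ∘ suc ∘ suc) vs)
                            drop-2 (λ J → cong (g 1 *_) (weight-shift² (elements J))) ⟩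
      subsetSum e (sized k noConsecutive) (λ vs → g 1 * weight (g ∘ suc ∘ suc) vs)
        ≡⟨ subsetSum-*ˡ e (sized k noConsecutive) (weight (g ∘ suc ∘ suc)) (g 1) ⟩
      g 1 * subsetSum e (sized k noConsecutive) (weight (g ∘ suc ∘ suc))
        ≡⟨ cong (g 1 *_) (subsetSum-indep (g ∘ suc ∘ suc) e k) ⟩
      g 1 * indep (g ∘ suc ∘ suc) e k ∎
      where
      weight-shift² : ∀ vs → weight g (map suc (map suc vs)) ≡ weight (g ∘ suc ∘ suc) vs
      weight-shift² vs = trans (weight-shift g (map suc vs)) (weight-shift (g ∘ suc) vs)
      drop-2 : ∀ (J : Sub e) → Φ (1 ∷ map suc (map suc (elements J))) ≡ sized k noConsecutive (elements J)
      drop-2 J = cong₂ _∧_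
        (cong (_≡ᵇ k) (trans (length-map suc (map suc (elements J))) (length-map suc (elements J))))
        (trans (noConsecutive-1∷ (map suc (elements J)))
               (cong₂ _∧_ (trans (all-map _ suc (elements J)) (elements-nonzero J))
                          (noConsecutive-shift (elements J))))

  sumOver-none : ∀ n P f → (∀ J → P J ≡ false) → sumOver n P f ≡ 0
  sumOver-none n P f none = trans (sum-map-filterᵇ P f (allSubsets n)) (sumWhen-none P f (allSubsets n) none)

  length-elements : ∀ {n} (J : Sub n) → card J ≡ length (elements J)
  length-elements J = sym (length-map elt (members J))

  prodOver-weight : ∀ {n} g (J : Sub n) → prodOver g J ≡ weight g (elements J)
  prodOver-weight g J = cong product (map-∘ (members J))

  sumOver-inStar : ∀ n k g → sumOver n (inStar n (ℤ.+ k)) (prodOver g) ≡ esym (sameParityᵇ n) g n k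
  sumOver-inStar n k g =
    trans (sumOver-subsetSum n (inStar n (ℤ.+ k)) (prodOver g) (sized k (all (sameParityᵇ n))) (weight g)
             (λ J → cong₂ _∧_ (cong (_≡ᵇ k) (length-elements J))
                              (sym (all-map (sameParityᵇ n) elt (members J))))
             (prodOver-weight g))
          (subsetSum-esym (sameParityᵇ n) g n k)

  sumOver-inStarStar : ∀ n k g → sumOver n (inStarStar n (ℤ.+ k)) (prodOver g) ≡ indep g n k
  sumOver-inStarStar n k g =
    trans (sumOver-subsetSum n (inStarStar n (ℤ.+ k)) (prodOver g) (sized k noConsecutive) (weight g)
             (λ J → cong₂ _∧_ (cong (_≡ᵇ k) (length-elements J)) (sym (noConsecutive-elements J)))
             (prodOver-weight g))
          (subsetSum-indep g n k)
    where
    noConsecutive-elements : ∀ {n} (J : Sub n) → noConsecutive (elements J) ≡ noConsec n J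
    noConsecutive-elements J =
      trans (all-map _ elt (members J))
            (all-cong (λ i → all-map (λ b → not (b ≡ᵇ suc (elt i))) elt (members J)) (members J))

open import Data.Nat using (ℕ; suc; _*_; _∸_; _+_; NonZero)
open import Data.Nat.Properties using (+-comm)
open import Data.Integer using (ℤ; +_; -[1+_])
open WeightedCounts using (square; squareEsym; indep; kacWeight)
open KacPolynomials using (squareEsym≡indep-kacWeight)
open SubsetSums using (sumOver-none; sumOver-inStar; sumOver-inStarStar)

mainTheorem1 : (n : ℕ) → .{{_ : NonZero n}} → (k : ℤ) →
    sumOver n (inStar n k) (prodOver (λ j → j * j))
      ≡ sumOver n (inStarStar n k) (prodOver (λ j → j * (n + 1 ∸ j)))
mainTheorem1 n -[1+ _ ] = trans (sumOver-none n _ _ λ _ → refl) (sym (sumOver-none n _ _ λ _ → refl))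
mainTheorem1 n (+ k)    = begin
  sumOver n (inStar n (+ k)) (prodOver square)             ≡⟨ sumOver-inStar n k square ⟩
  squareEsym n k                                           ≡⟨ squareEsym≡indep-kacWeight n k ⟩
  indep (kacWeight (suc n)) n k                            ≡⟨ cong (λ N → indep (kacWeight N) n k) (+-comm 1 n) ⟩
  indep (kacWeight (n + 1)) n k                            ≡⟨ sumOver-inStarStar n k (kacWeight (n + 1)) ⟨
  sumOver n (inStarStar n (+ k)) (prodOver (kacWeight (n + 1))) ∎
  where open ≡-Reasoning
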